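{- For all positive integers $a$ and $b$, \[\gamma_{a,b} \leqslant \gamma_{a+1,b} \leqslant \max\{\gamma_{a,b}, \gamma_{1,a+b}\}.\]
   Context: Graphs are finite and simple; $|G|$ is the number of vertices, $\delta(G)$ the minimum degree. A graph is $a$-locally $b$-partite if for every clique on $a$ vertices, the subgraph induced on the common neighbourhood of its vertices is $b$-colourable; $\mathcal{F}_{a,b}$ is the family of $a$-locally $b$-partite graphs. For a family $\mathcal{F}$ and positive integer $k$, $\delta_{\chi}(\mathcal{F},k) = \inf\{d : \text{every } G\in\mathcal{F} \text{ with } \delta(G)\geqslant d|G| \text{ satisfies } \chi(G)\leqslant k\}$. The real number $\gamma_{a,b}$ is defined by $\delta_{\chi}(\mathcal{F}_{a,b}, a+b) = 1 - \frac{1}{a+b-1+\gamma_{a,b}}$. -}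

module Defs where

open import Data.Nat using (ℕ; zero; suc)
import Data.Nat as ℕ
open import Data.Bool using (Bool; true; false; if_then_else_)
open import Data.Fin using (Fin)
open import Data.List using (List; map; allFin)
open import Data.Nat.ListAction using (sum)
open import Data.Integer using (+_)
open import Data.Rational using (ℚ; _/_; _≤_; _<_; _+_; _-_; _*_; 0ℚ; 1ℚ; 1/_; >-nonZero)
open import Data.Product using (Σ; _×_; ∃; ∃-syntax)
open import Relation.Binary.PropositionalEquality using (_≡_; _≢_)
open import Function.Definitions using (Injective)

record Graph (n : ℕ) : Set where
  field
    E     : Fin n → Fin n → Bool
    sym   : ∀ i j → E i j ≡ E j i
    irref : ∀ i → E i i ≡ false
open Graph public

Adj : ∀ {n} → Graph n → Fin n → Fin n → Set
Adj G i j = E G i j ≡ true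

ℕ→ℚ : ℕ → ℚ
ℕ→ℚ m = + m / 1

deg : ∀ {n} → Graph n → Fin n → ℕ
deg {n} G v = sum (map (λ j → if E G v j then 1 else 0) (allFin n))

MinDegAtLeast : ∀ {n} → Graph n → ℚ → Set
MinDegAtLeast {n} G d = ∀ v → d * ℕ→ℚ n ≤ ℕ→ℚ (deg G v)

ChromAtMost : ∀ {n} → Graph n → ℕ → Set
ChromAtMost {n} G k = Σ (Fin n → Fin k) λ c → ∀ i j → Adj G i j → c i ≢ c j

IsClique : ∀ {n a} → Graph n → (Fin a → Fin n) → Set
IsClique G K = Injective _≡_ _≡_ K × (∀ x y → x ≢ y → Adj G (K x) (K y))

InCommonNbhd : ∀ {n a} → Graph n → (Fin a → Fin n) → Fin n → Set
InCommonNbhd G K v = ∀ x → Adj G (K x) v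

CommonNbhdColourable : ∀ {n a} → Graph n → (Fin a → Fin n) → ℕ → Set
CommonNbhdColourable {n} G K b =
  Σ (Σ (Fin n) (InCommonNbhd G K) → Fin b) λ c →
    ∀ (u w : Σ (Fin n) (InCommonNbhd G K)) →
      Adj G (Σ.proj₁ u) (Σ.proj₁ w) → c u ≢ c w

LocallyPartite : ∀ {n} → ℕ → ℕ → Graph n → Set
LocallyPartite {n} a b G =
  ∀ (K : Fin a → Fin n) → IsClique G K → CommonNbhdColourable G K b

-- d is admissible in the infimum defining δ_χ(𝓕_{a,b}, k):
-- every G ∈ 𝓕_{a,b} with δ(G) ≥ d|G| has χ(G) ≤ k.
DeltaChiGood : ℕ → ℕ → ℕ → ℚ → Set
DeltaChiGood a b k d =
  ∀ (n : ℕ) (G : Graph n) → LocallyPartite a b G → MinDegAtLeast G d → ChromAtMost G k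

-- γ_{a,b} < q.
-- γ_{a,b} is defined by δ_χ(𝓕_{a,b}, a+b) = 1 - 1/(a+b-1+γ_{a,b}).
-- Writing c = a+b-1 and f(g) = 1 - 1/(c+g) (increasing bijection (-c,∞) → (-∞,1)),
-- γ_{a,b} < q  iff  some rational g < q with c+g > 0 has f(g) admissible.
GammaBelow : ℕ → ℕ → ℚ → Set
GammaBelow a b q =
  ∃[ g ] (g < q × Σ (0ℚ < ℕ→ℚ (a ℕ.+ b ℕ.∸ 1) + g) λ pos →
    DeltaChiGood a b (a ℕ.+ b)
      (1ℚ - (1/ (ℕ→ℚ (a ℕ.+ b ℕ.∸ 1) + g)) {{>-nonZero pos}}))

-- γ_{a,b} ≤ γ_{a+1,b}: let G ∈ 𝓕_{a,b} have δ(G) ≥ (1 − r/p)|G|. Blowing up the cone over G, with the apex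
-- replaced by r|G| copies and every other vertex by p copies, gives a graph in 𝓕_{a+1,b} of minimum degree at
-- least (1 − r/(p+r)) times its order; an (a+b+1)-colouring of it yields one of the cone, hence an
-- (a+b)-colouring of G. A witness without positive denominator p/r is ruled out because 𝓕_{a+1,b} contains
-- graphs of chromatic number above a+b+1 (iterated cones over triangle-free Mycielski graphs).
--
-- γ_{a+1,b} ≤ max{γ_{a,b}, γ_{1,a+b}}: if G ∈ 𝓕_{a+1,b} is dense enough, the neighbourhood of each vertex v
-- induces a graph in 𝓕_{a,b} in which u has degree at least deg u + deg v − |G|; this is dense enough for
-- the γ_{a,b} bound, so every neighbourhood is (a+b)-colourable, G ∈ 𝓕_{1,a+b}, and G is (a+b+1)-colourable.

module Submission where

open import Defs hiding (sym)
open import Data.Nat as ℕ using (ℕ; zero; suc; _+_; _*_; _≤_; z≤n; s≤s)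
import Data.Nat.Properties as ℕ
import Data.Nat.ListAction as List
open import Algebra.Properties.Semiring.Sum ℕ.+-*-semiring
  using (sum-cong-≗; ∑-distrib-+; *-distribˡ-sum) renaming (sum to ∑)
open import Data.Bool using (Bool; true; false; if_then_else_)
open import Data.Fin as Fin using (Fin; zero; suc; splitAt; _↑ˡ_; _↑ʳ_; punchIn; punchOut)
import Data.Fin.Properties as Fin
import Data.Vec.Functional as Vector
open import Data.List using (map; allFin; tabulate; []; _∷_)
import Data.List.Properties as List
open import Data.Sum using (_⊎_; inj₁; inj₂; [_,_]′)
open import Data.Product using (Σ; _×_; _,_; proj₁; proj₂)
open import Data.Empty using (⊥; ⊥-elim)
open import Relation.Nullary using (¬_; yes; no)
open import Function using (_∘_; const)
open import Relation.Binary.PropositionalEquality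
open import Data.Integer as ℤ using (+[1+_]; +0; -[1+_])
import Data.Integer.Properties as ℤ
open import Data.Rational as ℚ using (ℚ; mkℚ; 0ℚ; 1ℚ; 1/_)
import Data.Rational.Properties as ℚ
open import Data.Rational.Unnormalised as ℚᵘ using (mkℚᵘ; *≡*)
import Data.Rational.Unnormalised.Properties as ℚᵘ
import Data.Nat.Coprimality as Coprime
open import Data.Rational.Solver using (module +-*-Solver)
open +-*-Solver using (con; _:+_; _:*_; _:-_; :-_; _:=_) renaming (solve to solveℚ)
open import Data.Nat.Tactic.RingSolver using (solve)

∑-const : ∀ n m → ∑ {n} (const m) ≡ n * m
∑-const zero    m = refl
∑-const (suc n) m = cong (m +_) (∑-const n m)

∑-mono-≤ : ∀ {n} {f g : Fin n → ℕ} → (∀ i → f i ≤ g i) → ∑ f ≤ ∑ g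
∑-mono-≤ {zero}  f≤g = z≤n
∑-mono-≤ {suc n} f≤g = ℕ.+-mono-≤ (f≤g zero) (∑-mono-≤ (f≤g ∘ suc))

∑-splitAt : ∀ m {k} (f : Fin (m + k) → ℕ) → ∑ f ≡ ∑ (f ∘ (_↑ˡ k)) + ∑ (f ∘ (m ↑ʳ_))
∑-splitAt zero    f = refl
∑-splitAt (suc m) f = trans (cong (f zero +_) (∑-splitAt m (f ∘ suc))) (sym (ℕ.+-assoc (f zero) _ _))

sum-map-allFin : ∀ n (f : Fin n → ℕ) → List.sum (map f (allFin n)) ≡ ∑ f
sum-map-allFin n f = trans (cong List.sum (List.map-tabulate (λ i → i) f)) (sum-tabulate n f)
  where
  sum-tabulate : ∀ n (f : Fin n → ℕ) → List.sum (tabulate f) ≡ ∑ f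
  sum-tabulate zero    f = refl
  sum-tabulate (suc n) f = cong (f zero +_) (sum-tabulate n (f ∘ suc))

-- Every u has exactly w u preimages.
blowup : ∀ {n} (w : Fin n → ℕ) → Fin (∑ w) → Fin n
blowup {suc n} w j = [ const zero , suc ∘ blowup (w ∘ suc) ]′ (splitAt (w zero) j)

∑-∘blowup : ∀ {n} (w f : Fin n → ℕ) → ∑ (f ∘ blowup w) ≡ ∑ (λ u → w u * f u)
∑-∘blowup {zero}  w f = refl
∑-∘blowup {suc n} w f = begin
  ∑ (f ∘ blowup w)
    ≡⟨ ∑-splitAt (w zero) (f ∘ blowup w) ⟩
  ∑ (f ∘ blowup w ∘ (_↑ˡ N)) + ∑ (f ∘ blowup w ∘ (w zero ↑ʳ_))
    ≡⟨ cong₂ _+_ (sum-cong-≗ (λ i → cong (f ∘ pick) (Fin.splitAt-↑ˡ (w zero) i N)))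
                 (sum-cong-≗ (λ i → cong (f ∘ pick) (Fin.splitAt-↑ʳ (w zero) N i))) ⟩
  ∑ {w zero} (const (f zero)) + ∑ (f ∘ suc ∘ blowup (w ∘ suc))
    ≡⟨ cong₂ _+_ (∑-const (w zero) (f zero)) (∑-∘blowup (w ∘ suc) (f ∘ suc)) ⟩
  w zero * f zero + ∑ (λ u → w (suc u) * f (suc u))
    ∎
  where
  open ≡-Reasoning
  N : ℕ
  N = ∑ (w ∘ suc)
  pick : Fin (w zero) ⊎ Fin N → Fin (suc n)
  pick = [ const zero , suc ∘ blowup (w ∘ suc) ]′

blowup-weight : ∀ {n} (w : Fin n → ℕ) j → 1 ≤ w (blowup w j)
blowup-weight {suc n} w j with splitAt (w zero) j
... | inj₁ i = ℕ.≤-trans (s≤s z≤n) (Fin.toℕ<n i)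
... | inj₂ i = blowup-weight (w ∘ suc) i

copy : ∀ {n} (w : Fin n → ℕ) u → 1 ≤ w u → Fin (∑ w)
copy {suc n} w zero    w≥1 = Fin.fromℕ< w≥1 ↑ˡ _
copy {suc n} w (suc u) w≥1 = w zero ↑ʳ copy (w ∘ suc) u w≥1

blowup-copy : ∀ {n} (w : Fin n → ℕ) u (w≥1 : 1 ≤ w u) → blowup w (copy w u w≥1) ≡ u
blowup-copy {suc n} w zero    w≥1 = cong [ const zero , _ ]′ (Fin.splitAt-↑ˡ (w zero) _ _)
blowup-copy {suc n} w (suc u) w≥1 =
  trans (cong [ _ , suc ∘ blowup (w ∘ suc) ]′ (Fin.splitAt-↑ʳ (w zero) _ _)) (cong suc (blowup-copy (w ∘ suc) u w≥1))

𝟙 : Bool → ℕ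
𝟙 b = if b then 1 else 0

𝟙+𝟙≤𝟙*𝟙+1 : ∀ b c → 𝟙 b + 𝟙 c ≤ 𝟙 c * 𝟙 b + 1
𝟙+𝟙≤𝟙*𝟙+1 true  true  = ℕ.≤-refl
𝟙+𝟙≤𝟙*𝟙+1 true  false = ℕ.≤-refl
𝟙+𝟙≤𝟙*𝟙+1 false true  = ℕ.≤-refl
𝟙+𝟙≤𝟙*𝟙+1 false false = z≤n

adjacency : ∀ {n} → Graph n → Fin n → Fin n → ℕ
adjacency G v u = 𝟙 (E G v u)

deg≡∑adjacency : ∀ {n} (G : Graph n) v → deg G v ≡ ∑ (adjacency G v)
deg≡∑adjacency {n} G v = sum-map-allFin n (adjacency G v)

adjacency-pos⇒Adj : ∀ {n} (G : Graph n) {v u} → 1 ≤ adjacency G v u → Adj G v u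
adjacency-pos⇒Adj G {v} {u} _ with E G v u
adjacency-pos⇒Adj G (s≤s _) | true = refl

Adj⇒adjacency-pos : ∀ {n} (G : Graph n) {v u} → Adj G v u → 1 ≤ adjacency G v u
Adj⇒adjacency-pos G eq rewrite eq = s≤s z≤n

Adj-subst : ∀ {n} (G : Graph n) {u u′ w w′} → u ≡ u′ → w ≡ w′ → Adj G u w → Adj G u′ w′
Adj-subst G refl refl a = a

Adj-sym : ∀ {n} (G : Graph n) {u w} → Adj G u w → Adj G w u
Adj-sym G {u} {w} a = trans (Graph.sym G w u) a

Adj⇒≢ : ∀ {n} (G : Graph n) {u w} → Adj G u w → u ≢ w
Adj⇒≢ G {u} a refl with trans (sym a) (irref G u)
... | ()

pullback : ∀ {m n} → Graph n → (Fin m → Fin n) → Graph m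
pullback G φ = record
  { E     = λ i j → E G (φ i) (φ j)
  ; sym   = λ i j → Graph.sym G (φ i) (φ j)
  ; irref = λ i → irref G (φ i)
  }

deg-pullback-blowup : ∀ {n} (G : Graph n) (w : Fin n → ℕ) j →
  deg (pullback G (blowup w)) j ≡ ∑ (λ u → w u * adjacency G (blowup w j) u)
deg-pullback-blowup G w j =
  trans (deg≡∑adjacency (pullback G (blowup w)) j) (∑-∘blowup w (adjacency G (blowup w j)))

chromAtMost-hom : ∀ {m n k} {G : Graph m} {H : Graph n} (f : Fin m → Fin n) →
  (∀ {i j} → Adj G i j → Adj H (f i) (f j)) → ChromAtMost H k → ChromAtMost G k
chromAtMost-hom f f-adj (c , proper) = c ∘ f , λ i j a → proper (f i) (f j) (f-adj a)

chromAtMost-pullback-section : ∀ {m n k} (G : Graph n) {φ : Fin m → Fin n} (ψ : Fin n → Fin m) →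
  (∀ u → φ (ψ u) ≡ u) → ChromAtMost (pullback G φ) k → ChromAtMost G k
chromAtMost-pullback-section G {φ} ψ φψ =
  chromAtMost-hom {G = G} {pullback G φ} ψ λ {i} {j} → Adj-subst G (sym (φψ i)) (sym (φψ j))

chromAtMost-avoiding : ∀ {n k} {G : Graph n} (c : Fin n → Fin (suc k)) {κ : Fin (suc k)} →
  (∀ v → κ ≢ c v) → (∀ i j → Adj G i j → c i ≢ c j) → ChromAtMost G k
chromAtMost-avoiding c κ∉c proper =
  (λ v → punchOut (κ∉c v)) , λ i j a e → proper i j a (Fin.punchOut-injective (κ∉c i) (κ∉c j) e)

coneE : ∀ {n} → Graph n → Fin (suc n) → Fin (suc n) → Bool
coneE G zero    zero    = false
coneE G zero    (suc _) = true
coneE G (suc _) zero    = true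
coneE G (suc i) (suc j) = E G i j

cone : ∀ {n} → Graph n → Graph (suc n)
cone G = record { E = coneE G ; sym = coneE-sym ; irref = coneE-irref }
  where
  coneE-sym : ∀ i j → coneE G i j ≡ coneE G j i
  coneE-sym zero    zero    = refl
  coneE-sym zero    (suc _) = refl
  coneE-sym (suc _) zero    = refl
  coneE-sym (suc i) (suc j) = Graph.sym G i j
  coneE-irref : ∀ i → coneE G i i ≡ false
  coneE-irref zero    = refl
  coneE-irref (suc i) = irref G i

chromAtMost-cone : ∀ {n k} {G : Graph n} → ChromAtMost (cone G) (suc k) → ChromAtMost G k
chromAtMost-cone {G = G} (c , proper) =
  chromAtMost-avoiding {G = G} (c ∘ suc) (λ v → proper zero (suc v) refl) (λ i j → proper (suc i) (suc j))

CommonNbhd : ∀ {n a} → Graph n → (Fin a → Fin n) → Set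
CommonNbhd {n} G K = Σ (Fin n) (InCommonNbhd G K)

commonNbhdColourable-hom : ∀ {m n a c b} (H : Graph m) (G : Graph n) {K : Fin a → Fin m} {L : Fin c → Fin n}
  (f : CommonNbhd H K → CommonNbhd G L) →
  (∀ u w → Adj H (proj₁ u) (proj₁ w) → Adj G (proj₁ (f u)) (proj₁ (f w))) →
  CommonNbhdColourable G L b → CommonNbhdColourable H K b
commonNbhdColourable-hom H G f f-adj (c , proper) = c ∘ f , λ u w a → proper (f u) (f w) (f-adj u w a)

clique-∘injective : ∀ {n a c} (G : Graph n) {K : Fin a → Fin n} {ι : Fin c → Fin a} →
  IsClique G K → (∀ {x y} → ι x ≡ ι y → x ≡ y) → IsClique G (K ∘ ι)
clique-∘injective G (K-inj , K-adj) ι-inj = ι-inj ∘ K-inj , λ x y x≢y → K-adj _ _ (x≢y ∘ ι-inj)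

clique-pullback : ∀ {m n a} (G : Graph n) {φ : Fin m → Fin n} {K : Fin a → Fin m} →
  IsClique (pullback G φ) K → IsClique G (φ ∘ K)
clique-pullback G {φ} {K} (_ , K-adj) = φK-inj , K-adj
  where
  φK-inj : ∀ {x y} → φ (K x) ≡ φ (K y) → x ≡ y
  φK-inj {x} {y} e with x Fin.≟ y
  ... | yes x≡y = x≡y
  ... | no  x≢y = ⊥-elim (Adj⇒≢ G (K-adj x y x≢y) e)

clique-∷ : ∀ {n a} (G : Graph n) {K : Fin a → Fin n} {v} →
  IsClique G K → (∀ x → Adj G v (K x)) → IsClique G (v Vector.∷ K)
clique-∷ G {K} {v} (K-inj , K-adj) v~K = inj , adj
  where
  inj : ∀ {x y} → (v Vector.∷ K) x ≡ (v Vector.∷ K) y → x ≡ y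
  inj {zero}  {zero}  _ = refl
  inj {zero}  {suc y} e = ⊥-elim (Adj⇒≢ G (v~K y) e)
  inj {suc x} {zero}  e = ⊥-elim (Adj⇒≢ G (v~K x) (sym e))
  inj {suc x} {suc y} e = cong suc (K-inj e)
  adj : ∀ x y → x ≢ y → Adj G ((v Vector.∷ K) x) ((v Vector.∷ K) y)
  adj zero    zero    x≢y = ⊥-elim (x≢y refl)
  adj zero    (suc y) _   = v~K y
  adj (suc x) zero    _   = Adj-sym G (v~K x)
  adj (suc x) (suc y) x≢y = K-adj x y (x≢y ∘ cong suc)

locallyPartite-pullback : ∀ {m n a b} {G : Graph n} {φ : Fin m → Fin n} →
  LocallyPartite a b G → LocallyPartite a b (pullback G φ)
locallyPartite-pullback {G = G} {φ} lp K K-clique =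
  commonNbhdColourable-hom (pullback G φ) G {K} {φ ∘ K} (λ (u , u∈N) → φ u , u∈N) (λ _ _ a → a)
    (lp (φ ∘ K) (clique-pullback G {φ} K-clique))

locallyPartite-pullback-nbhd : ∀ {m n a b} {G : Graph n} {φ : Fin m → Fin n} {v} →
  (∀ j → Adj G v (φ j)) → LocallyPartite (suc a) b G → LocallyPartite a b (pullback G φ)
locallyPartite-pullback-nbhd {G = G} {φ} {v} v~φ lp K K-clique =
  commonNbhdColourable-hom (pullback G φ) G {K} {v Vector.∷ φ ∘ K}
    (λ (u , u∈N) → φ u , λ { zero → v~φ u ; (suc x) → u∈N x }) (λ _ _ a → a)
    (lp (v Vector.∷ φ ∘ K) (clique-∷ G (clique-pullback G {φ} K-clique) (v~φ ∘ K)))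

unapex : ∀ {n} {u : Fin (suc n)} → u ≢ zero → Fin n
unapex {u = zero}  u≢0 = ⊥-elim (u≢0 refl)
unapex {u = suc u} _   = u

suc-unapex : ∀ {n} {u : Fin (suc n)} (u≢0 : u ≢ zero) → suc (unapex u≢0) ≡ u
suc-unapex {u = zero}  u≢0 = ⊥-elim (u≢0 refl)
suc-unapex {u = suc u} _   = refl

clique-unapex : ∀ {n a} (G : Graph n) {K : Fin a → Fin (suc n)} →
  IsClique (cone G) K → (K≢0 : ∀ x → K x ≢ zero) → IsClique G (λ x → unapex (K≢0 x))
clique-unapex G (K-inj , K-adj) K≢0 =
  (λ {x} {y} e → K-inj (trans (sym (suc-unapex (K≢0 x))) (trans (cong suc e) (suc-unapex (K≢0 y))))) ,
  (λ x y x≢y → Adj-subst (cone G) (sym (suc-unapex (K≢0 x))) (sym (suc-unapex (K≢0 y))) (K-adj x y x≢y))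

cone-commonNbhdColourable-apex : ∀ {n a b} {G : Graph n} {K : Fin (suc a) → Fin (suc n)} {x} →
  LocallyPartite a b G → IsClique (cone G) K → K x ≡ zero → CommonNbhdColourable (cone G) K b
cone-commonNbhdColourable-apex {n} {a} {b} {G} {K} {x} lp K-clique Kx≡0 =
  commonNbhdColourable-hom (cone G) G {K} {L} f f-adj (lp L L-clique)
  where
  K′≢0 : ∀ i → K (punchIn x i) ≢ zero
  K′≢0 i e = Fin.punchInᵢ≢i x i (proj₁ K-clique (trans e (sym Kx≡0)))
  L : Fin a → Fin n
  L i = unapex (K′≢0 i)
  L-clique : IsClique G L
  L-clique = clique-unapex G (clique-∘injective (cone G) K-clique (Fin.punchIn-injective x _ _)) K′≢0
  f : CommonNbhd (cone G) K → CommonNbhd G L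
  f (zero  , u∈N) = ⊥-elim (Adj⇒≢ (cone G) (u∈N x) Kx≡0)
  f (suc u , u∈N) = u , λ i → Adj-subst (cone G) (sym (suc-unapex (K′≢0 i))) refl (u∈N (punchIn x i))
  f-adj : ∀ u w → Adj (cone G) (proj₁ u) (proj₁ w) → Adj G (proj₁ (f u)) (proj₁ (f w))
  f-adj (zero  , u∈N) _             _ = ⊥-elim (Adj⇒≢ (cone G) (u∈N x) Kx≡0)
  f-adj (suc _ , _)   (zero , w∈N)  _ = ⊥-elim (Adj⇒≢ (cone G) (w∈N x) Kx≡0)
  f-adj (suc _ , _)   (suc _ , _)   a = a

cone-commonNbhdColourable-noApex : ∀ {n a b} {G : Graph n} {K : Fin (suc a) → Fin (suc n)} →
  LocallyPartite a b G → IsClique (cone G) K → (∀ x → K x ≢ zero) → CommonNbhdColourable (cone G) K b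
cone-commonNbhdColourable-noApex {n} {a} {b} {G} {K} lp K-clique K≢0 =
  commonNbhdColourable-hom (cone G) G {K} {L ∘ suc} f f-adj (lp (L ∘ suc) (clique-∘injective G L-clique Fin.suc-injective))
  where
  L : Fin (suc a) → Fin n
  L x = unapex (K≢0 x)
  L-clique : IsClique G L
  L-clique = clique-unapex G K-clique K≢0
  L₀~ : ∀ {w} → InCommonNbhd (cone G) K (suc w) → Adj G (L zero) w
  L₀~ w∈N = Adj-subst (cone G) (sym (suc-unapex (K≢0 zero))) refl (w∈N zero)
  f : CommonNbhd (cone G) K → CommonNbhd G (L ∘ suc)
  f (zero  , _)   = L zero , λ i → proj₂ L-clique (suc i) zero λ ()
  f (suc u , u∈N) = u , λ i → Adj-subst (cone G) (sym (suc-unapex (K≢0 (suc i)))) refl (u∈N (suc i))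
  f-adj : ∀ u w → Adj (cone G) (proj₁ u) (proj₁ w) → Adj G (proj₁ (f u)) (proj₁ (f w))
  f-adj (zero  , _)   (zero  , _)   ()
  f-adj (zero  , _)   (suc _ , w∈N) _ = L₀~ w∈N
  f-adj (suc _ , u∈N) (zero  , _)   _ = Adj-sym G (L₀~ u∈N)
  f-adj (suc _ , _)   (suc _ , _)   a = a

locallyPartite-cone : ∀ {n a b} {G : Graph n} → LocallyPartite a b G → LocallyPartite (suc a) b (cone G)
locallyPartite-cone lp K K-clique with Fin.any? (λ x → K x Fin.≟ zero)
... | yes (_ , Kx≡0) = cone-commonNbhdColourable-apex lp K-clique Kx≡0
... | no  apex∉K     = cone-commonNbhdColourable-noApex lp K-clique (λ x Kx≡0 → apex∉K (x , Kx≡0))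

nbhdGraph : ∀ {n} (G : Graph n) (v : Fin n) → Graph (∑ (adjacency G v))
nbhdGraph G v = pullback G (blowup (adjacency G v))

locallyPartite-nbhdGraph : ∀ {n a b} (G : Graph n) v → LocallyPartite (suc a) b G → LocallyPartite a b (nbhdGraph G v)
locallyPartite-nbhdGraph G v =
  locallyPartite-pullback-nbhd {G = G} (λ j → adjacency-pos⇒Adj G (blowup-weight (adjacency G v) j))

commonNbhdColourable-nbhdGraph : ∀ {n k} (G : Graph n) (K : Fin 1 → Fin n) →
  ChromAtMost (nbhdGraph G (K zero)) k → CommonNbhdColourable G K k
commonNbhdColourable-nbhdGraph {n} G K (c , proper) = c ∘ ψ , λ u w u~w → proper (ψ u) (ψ w) (ψ-adj u w u~w)
  where
  w : Fin n → ℕ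
  w = adjacency G (K zero)
  ψ : CommonNbhd G K → Fin (∑ w)
  ψ (u , u∈N) = copy w u (Adj⇒adjacency-pos G (u∈N zero))
  ψ-adj : ∀ u w → Adj G (proj₁ u) (proj₁ w) → Adj (nbhdGraph G (K zero)) (ψ u) (ψ w)
  ψ-adj (u , u∈N) (w , w∈N) = Adj-subst G (sym (blowup-copy _ u (Adj⇒adjacency-pos G (u∈N zero))))
                                           (sym (blowup-copy _ w (Adj⇒adjacency-pos G (w∈N zero))))

deg-nbhdGraph : ∀ {n} (G : Graph n) v j →
  deg G (blowup (adjacency G v) j) + deg G v ≤ deg (nbhdGraph G v) j + n
deg-nbhdGraph {n} G v j = begin
  deg G x + deg G v                                   ≡⟨ cong₂ _+_ (deg≡∑adjacency G x) (deg≡∑adjacency G v) ⟩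
  ∑ (adjacency G x) + ∑ (adjacency G v)               ≡⟨ ∑-distrib-+ (adjacency G x) (adjacency G v) ⟨
  ∑ (λ u → adjacency G x u + adjacency G v u)         ≤⟨ ∑-mono-≤ (λ u → 𝟙+𝟙≤𝟙*𝟙+1 (E G x u) (E G v u)) ⟩
  ∑ (λ u → adjacency G v u * adjacency G x u + 1)     ≡⟨ ∑-distrib-+ (λ u → adjacency G v u * adjacency G x u)
                                                                   (const 1) ⟩
  ∑ (λ u → adjacency G v u * adjacency G x u) + ∑ {n} (const 1)
                                                      ≡⟨ cong₂ _+_ (sym (deg-pullback-blowup G (adjacency G v) j))
                                                                   (trans (∑-const n 1) (ℕ.*-identityʳ n)) ⟩
  deg (nbhdGraph G v) j + n                           ∎
  where
  open ℕ.≤-Reasoning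
  x : Fin n
  x = blowup (adjacency G v) j

TriangleFree : ∀ {n} → Graph n → Set
TriangleFree G = ∀ u v w → Adj G u v → Adj G v w → Adj G u w → ⊥

triangleFree⇒locallyPartite : ∀ {n b} {G : Graph n} → TriangleFree G → LocallyPartite 1 (suc b) G
triangleFree⇒locallyPartite tf K _ =
  const zero , λ (u , u∈N) (w , w∈N) u~w _ → tf (K zero) u w (u∈N zero) u~w (w∈N zero)

edgeless : ∀ n → Graph n
edgeless n = record { E = λ _ _ → false ; sym = λ _ _ → refl ; irref = λ _ → refl }

data MycielskiVertex (n : ℕ) : Set where
  apex        : MycielskiVertex n
  orig shadow : Fin n → MycielskiVertex n

module Mycielski {n} (G : Graph n) where

  edge : MycielskiVertex n → MycielskiVertex n → Bool
  edge apex       apex       = false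
  edge apex       (orig _)   = false
  edge apex       (shadow _) = true
  edge (orig _)   apex       = false
  edge (orig v)   (orig w)   = E G v w
  edge (orig v)   (shadow w) = E G v w
  edge (shadow _) apex       = true
  edge (shadow v) (orig w)   = E G v w
  edge (shadow _) (shadow _) = false

  edge-sym : ∀ x y → edge x y ≡ edge y x
  edge-sym apex       apex       = refl
  edge-sym apex       (orig _)   = refl
  edge-sym apex       (shadow _) = refl
  edge-sym (orig _)   apex       = refl
  edge-sym (orig v)   (orig w)   = Graph.sym G v w
  edge-sym (orig v)   (shadow w) = Graph.sym G v w
  edge-sym (shadow _) apex       = refl
  edge-sym (shadow v) (orig w)   = Graph.sym G v w
  edge-sym (shadow _) (shadow _) = refl

  edge-irref : ∀ x → edge x x ≡ false
  edge-irref apex       = refl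
  edge-irref (orig v)   = irref G v
  edge-irref (shadow _) = refl

  -- A triangle avoids the apex and has at most one shadow; replacing it by its original gives a triangle of G.
  edge-triangleFree : TriangleFree G → ∀ x y z → edge x y ≡ true → edge y z ≡ true → edge x z ≡ true → ⊥
  edge-triangleFree tf (orig u)   (orig v)   (orig w)   = tf u v w
  edge-triangleFree tf (orig u)   (orig v)   (shadow w) = tf u v w
  edge-triangleFree tf (orig u)   (shadow v) (orig w)   = tf u v w
  edge-triangleFree tf (shadow u) (orig v)   (orig w)   = tf u v w
  edge-triangleFree _  apex       apex       _          ()
  edge-triangleFree _  apex       (orig _)   _          ()
  edge-triangleFree _  (orig _)   apex       _          ()
  edge-triangleFree _  (shadow _) (shadow _) _          ()
  edge-triangleFree _  _          apex       apex       _ ()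
  edge-triangleFree _  _          apex       (orig _)   _ ()
  edge-triangleFree _  _          (orig _)   apex       _ ()
  edge-triangleFree _  _          (shadow _) (shadow _) _ ()
  edge-triangleFree _  apex       _          apex       _ _ ()
  edge-triangleFree _  apex       _          (orig _)   _ _ ()
  edge-triangleFree _  (orig _)   _          apex       _ _ ()
  edge-triangleFree _  (shadow _) _          (shadow _) _ _ ()

  decode : Fin (suc (n + n)) → MycielskiVertex n
  decode zero    = apex
  decode (suc j) = [ orig , shadow ]′ (splitAt n j)

  encode : MycielskiVertex n → Fin (suc (n + n))
  encode apex       = zero
  encode (orig v)   = suc (v ↑ˡ n)
  encode (shadow v) = suc (n ↑ʳ v)

  decode-encode : ∀ x → decode (encode x) ≡ x
  decode-encode apex       = refl
  decode-encode (orig v)   = cong [ orig , shadow ]′ (Fin.splitAt-↑ˡ n v n)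
  decode-encode (shadow v) = cong [ orig , shadow ]′ (Fin.splitAt-↑ʳ n n v)

mycielski : ∀ {n} → Graph n → Graph (suc (n + n))
mycielski G = record
  { E     = λ i j → edge (decode i) (decode j)
  ; sym   = λ i j → edge-sym (decode i) (decode j)
  ; irref = λ i → edge-irref (decode i)
  }
  where open Mycielski G

triangleFree-mycielski : ∀ {n} {G : Graph n} → TriangleFree G → TriangleFree (mycielski G)
triangleFree-mycielski {G = G} tf i j l = edge-triangleFree tf (decode i) (decode j) (decode l)
  where open Mycielski G

-- Vertices coloured like the apex take the colour of their shadow instead.
chromAtMost-mycielski : ∀ {n k} {G : Graph n} → ChromAtMost (mycielski G) (suc k) → ChromAtMost G k
chromAtMost-mycielski {n} {k} {G} (c , proper) = chromAtMost-avoiding {G = G} recolour avoids recolour-proper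
  where
  open Mycielski G
  col : MycielskiVertex n → Fin (suc k)
  col = c ∘ encode
  col-proper : ∀ x y → edge x y ≡ true → col x ≢ col y
  col-proper x y x~y =
    proper (encode x) (encode y) (subst₂ (λ s t → edge s t ≡ true) (sym (decode-encode x)) (sym (decode-encode y)) x~y)
  recolour : Fin n → Fin (suc k)
  recolour v with col (orig v) Fin.≟ col apex
  ... | yes _ = col (shadow v)
  ... | no  _ = col (orig v)
  avoids : ∀ v → col apex ≢ recolour v
  avoids v with col (orig v) Fin.≟ col apex
  ... | yes _       = col-proper apex (shadow v) refl
  ... | no  v≢apex = v≢apex ∘ sym
  recolour-proper : ∀ v w → Adj G v w → recolour v ≢ recolour w
  recolour-proper v w v~w with col (orig v) Fin.≟ col apex | col (orig w) Fin.≟ col apex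
  ... | yes v≡apex | yes w≡apex = λ _ → col-proper (orig v) (orig w) v~w (trans v≡apex (sym w≡apex))
  ... | yes _      | no  _      = col-proper (shadow v) (orig w) v~w
  ... | no  _      | yes _      = col-proper (orig v) (shadow w) v~w
  ... | no  _      | no  _      = col-proper (orig v) (orig w) v~w

triangleFree-¬chromAtMost : ∀ k → Σ ℕ λ n → Σ (Graph n) λ G → TriangleFree G × ¬ ChromAtMost G k
triangleFree-¬chromAtMost zero = 1 , edgeless 1 , (λ _ _ _ ()) , λ (c , _) → Fin.¬Fin0 (c zero)
triangleFree-¬chromAtMost (suc k) with triangleFree-¬chromAtMost k
... | n , G , tf , ¬col = suc (n + n) , mycielski G , triangleFree-mycielski tf , ¬col ∘ chromAtMost-mycielski

locallyPartite-¬chromAtMost : ∀ a b →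
  Σ ℕ λ n → Σ (Graph n) λ G → LocallyPartite (suc a) (suc b) G × ¬ ChromAtMost G (suc a + suc b)
locallyPartite-¬chromAtMost zero b with triangleFree-¬chromAtMost (suc (suc b))
... | n , G , tf , ¬col = n , G , triangleFree⇒locallyPartite {G = G} tf , ¬col
locallyPartite-¬chromAtMost (suc a) b with locallyPartite-¬chromAtMost a b
... | n , G , lp , ¬col = suc n , cone G , locallyPartite-cone lp , ¬col ∘ chromAtMost-cone

-- Large p r n x means x ≥ (1 − r/p)·n, with the denominator cleared.
Large : ℕ → ℕ → ℕ → ℕ → Set
Large p r n x = p * n ≤ p * x + r * n

large-trivial : ∀ p r n x → p ≤ r → Large p r n x
large-trivial p r n x p≤r = ℕ.≤-trans (ℕ.*-monoˡ-≤ n p≤r) (ℕ.m≤n+m (r * n) (p * x))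

large-mono : ∀ p r p′ r′ n x → 1 ≤ p → p′ * r ≤ p * r′ → Large p r n x → Large p′ r′ n x
large-mono p r p′ r′ n x p≥1 p′r≤pr′ large = ℕ.*-cancelˡ-≤ p {{ℕ.>-nonZero p≥1}} (begin
  p * (p′ * n)              ≡⟨ solve (p ∷ p′ ∷ n ∷ []) ⟩
  p′ * (p * n)              ≤⟨ ℕ.*-monoʳ-≤ p′ large ⟩
  p′ * (p * x + r * n)      ≡⟨ solve (p ∷ p′ ∷ x ∷ r ∷ n ∷ []) ⟩
  p * (p′ * x) + p′ * r * n ≤⟨ ℕ.+-monoʳ-≤ (p * (p′ * x)) (ℕ.*-monoˡ-≤ n p′r≤pr′) ⟩
  p * (p′ * x) + p * r′ * n ≡⟨ solve (p ∷ p′ ∷ x ∷ r′ ∷ n ∷ []) ⟩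
  p * (p′ * x + r′ * n)     ∎)
  where open ℕ.≤-Reasoning

large-cone-apex : ∀ p r n → Large (p + r) r (r * n + n * p) (n * p)
large-cone-apex p r n = ℕ.≤-reflexive (solve (p ∷ r ∷ n ∷ []))

large-cone : ∀ p r n x → Large p r n x → Large (p + r) r (r * n + n * p) (r * n + p * x)
large-cone p r n x large = begin
  (p + r) * (r * n + n * p)                     ≡⟨ solve (p ∷ r ∷ n ∷ []) ⟩
  (p + r) * (r * n) + (p + r) * (p * n)         ≤⟨ ℕ.+-monoʳ-≤ ((p + r) * (r * n)) (ℕ.*-monoʳ-≤ (p + r) large) ⟩
  (p + r) * (r * n) + (p + r) * (p * x + r * n) ≡⟨ solve (p ∷ r ∷ n ∷ x ∷ []) ⟩
  (p + r) * (r * n + p * x) + r * (r * n + n * p) ∎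
  where open ℕ.≤-Reasoning

-- x, N are the degrees of adjacent vertices u, v of an n-vertex graph, and y ≥ x + N − n is the number
-- of their common neighbours.
large-nbhd : ∀ p r p₁ r₁ n x N y → 1 ≤ p → (p₁ + r₁) * r ≤ p * r₁ →
  Large p r n x → Large p r n N → x + N ≤ y + n → Large p₁ r₁ N y
large-nbhd p r p₁ r₁ n x N y p≥1 ratio large-x large-N x+N≤y+n =
  ℕ.*-cancelˡ-≤ p {{ℕ.>-nonZero p≥1}} (begin
    p * (p₁ * N)              ≡⟨ solve (p ∷ p₁ ∷ N ∷ []) ⟩
    p₁ * (p * N)              ≤⟨ ℕ.*-monoʳ-≤ p₁ N≤y+rn/p ⟩
    p₁ * (p * y + r * n)      ≡⟨ solve (p ∷ p₁ ∷ y ∷ r ∷ n ∷ []) ⟩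
    p * (p₁ * y) + p₁ * r * n ≤⟨ ℕ.+-monoʳ-≤ (p * (p₁ * y)) rn/p≤r₁N/p₁ ⟩
    p * (p₁ * y) + r₁ * p * N ≡⟨ solve (p ∷ p₁ ∷ y ∷ r₁ ∷ N ∷ []) ⟩
    p * (p₁ * y + r₁ * N)     ∎)
  where
  open ℕ.≤-Reasoning
  N≤y+rn/p : p * N ≤ p * y + r * n
  N≤y+rn/p = ℕ.+-cancelˡ-≤ (p * n) _ _ (begin
    p * n + p * N             ≤⟨ ℕ.+-monoˡ-≤ (p * N) large-x ⟩
    p * x + r * n + p * N     ≡⟨ solve (p ∷ x ∷ r ∷ n ∷ N ∷ []) ⟩
    p * (x + N) + r * n       ≤⟨ ℕ.+-monoˡ-≤ (r * n) (ℕ.*-monoʳ-≤ p x+N≤y+n) ⟩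
    p * (y + n) + r * n       ≡⟨ solve (p ∷ y ∷ n ∷ r ∷ []) ⟩
    p * n + (p * y + r * n)   ∎)
  rn/p≤r₁N/p₁ : p₁ * r * n ≤ r₁ * p * N
  rn/p≤r₁N/p₁ = ℕ.+-cancelʳ-≤ (r₁ * r * n) _ _ (begin
    p₁ * r * n + r₁ * r * n   ≡⟨ solve (p₁ ∷ r ∷ n ∷ r₁ ∷ []) ⟩
    (p₁ + r₁) * r * n         ≤⟨ ℕ.*-monoˡ-≤ n ratio ⟩
    p * r₁ * n                ≡⟨ solve (p ∷ r₁ ∷ n ∷ []) ⟩
    r₁ * (p * n)              ≤⟨ ℕ.*-monoʳ-≤ r₁ large-N ⟩
    r₁ * (p * N + r * n)      ≡⟨ solve (r₁ ∷ p ∷ N ∷ r ∷ n ∷ []) ⟩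
    r₁ * p * N + r₁ * r * n   ∎)

MinDegLarge : ∀ {n} → ℕ → ℕ → Graph n → Set
MinDegLarge {n} p r G = ∀ v → Large p r n (deg G v)

-- DeltaChiGood a b k (1 − r/p), with the degree condition cleared of denominators.
Admissible : ℕ → ℕ → ℕ → ℕ → ℕ → Set
Admissible a b k p r = ∀ n (G : Graph n) → LocallyPartite a b G → MinDegLarge p r G → ChromAtMost G k

admissible-mono : ∀ {a b k p r p′ r′} → 1 ≤ p → p′ * r ≤ p * r′ →
  Admissible a b k p′ r′ → Admissible a b k p r
admissible-mono {p = p} {r} {p′} {r′} p≥1 ratio adm n G lp large =
  adm n G lp (λ v → large-mono p r p′ r′ n (deg G v) p≥1 ratio (large v))

¬admissible-trivial : ∀ {a b p r} → p ≤ r → ¬ Admissible (suc a) (suc b) (suc a + suc b) p r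
¬admissible-trivial {a} {b} p≤r adm with locallyPartite-¬chromAtMost a b
... | n , G , lp , ¬col = ¬col (adm n G lp (λ v → large-trivial _ _ n (deg G v) p≤r))

admissible-cone : ∀ {a b k p r} → 1 ≤ p → 1 ≤ r → Admissible (suc a) b (suc k) (p + r) r → Admissible a b k p r
admissible-cone _ _ _ zero G _ _ = (λ ()) , λ ()
admissible-cone {k = k} {p} {r} p≥1 r≥1 adm n@(suc _) G lp large =
  chromAtMost-cone {G = G}
    (chromAtMost-pullback-section (cone G) {blowup w} ψ (λ u → blowup-copy w u (w-pos u)) H-colour)
  where
  w : Fin (suc n) → ℕ
  w zero    = r * n
  w (suc _) = p
  w-pos : ∀ u → 1 ≤ w u
  w-pos zero    = ℕ.*-mono-≤ r≥1 (s≤s z≤n)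
  w-pos (suc _) = p≥1
  ψ : Fin (suc n) → Fin (∑ w)
  ψ u = copy w u (w-pos u)
  H : Graph (∑ w)
  H = pullback (cone G) (blowup w)
  weighted-deg-large : ∀ u → Large (p + r) r (r * n + n * p) (∑ (λ u′ → w u′ * adjacency (cone G) u u′))
  weighted-deg-large zero    =
    subst (Large (p + r) r (r * n + n * p)) (sym apex-deg) (large-cone-apex p r n)
    where
    apex-deg : r * n * 0 + ∑ {n} (λ _ → p * 1) ≡ n * p
    apex-deg = cong₂ _+_ (ℕ.*-zeroʳ (r * n)) (trans (sum-cong-≗ {n} (λ _ → ℕ.*-identityʳ p)) (∑-const n p))
  weighted-deg-large (suc v) =
    subst (Large (p + r) r (r * n + n * p)) (sym vertex-deg) (large-cone p r n (deg G v) (large v))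
    where
    vertex-deg : r * n * 1 + ∑ (λ u → p * adjacency G v u) ≡ r * n + p * deg G v
    vertex-deg = cong₂ _+_ (ℕ.*-identityʳ (r * n))
                           (trans (sym (*-distribˡ-sum p (adjacency G v))) (cong (p *_) (sym (deg≡∑adjacency G v))))
  H-large : MinDegLarge (p + r) r H
  H-large j = subst₂ (Large (p + r) r) (cong (r * n +_) (sym (∑-const n p))) (sym (deg-pullback-blowup (cone G) w j))
                     (weighted-deg-large (blowup w j))
  H-colour : ChromAtMost H (suc k)
  H-colour = adm (∑ w) H (locallyPartite-pullback {G = cone G} {blowup w} (locallyPartite-cone {G = G} lp)) H-large

admissible-local : ∀ {a b k k′ p r p₁ r₁} → 1 ≤ p → (p₁ + r₁) * r ≤ p * r₁ →
  Admissible a b k p₁ r₁ → Admissible 1 k k′ p r → Admissible (suc a) b k′ p r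
admissible-local {k = k} {p = p} {r} {p₁} {r₁} p≥1 ratio adm₁ adm n G lp large = adm n G local large
  where
  nbhd-large : ∀ v → MinDegLarge p₁ r₁ (nbhdGraph G v)
  nbhd-large v j = subst (λ N → Large p₁ r₁ N (deg (nbhdGraph G v) j)) (deg≡∑adjacency G v)
    (large-nbhd p r p₁ r₁ n _ (deg G v) _ p≥1 ratio (large (blowup (adjacency G v) j)) (large v) (deg-nbhdGraph G v j))
  local : LocallyPartite 1 k G
  local K _ = commonNbhdColourable-nbhdGraph G K
    (adm₁ _ (nbhdGraph G (K zero)) (locallyPartite-nbhdGraph G (K zero) lp) (nbhd-large (K zero)))

ℕ→ℚ≡mkℚ : ∀ m → ℕ→ℚ m ≡ mkℚ (ℤ.+ m) 0 (Coprime.sym (Coprime.1-coprimeTo m))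
ℕ→ℚ≡mkℚ m = ℚ.normalize-coprime _

toℚᵘ-ℕ→ℚ : ∀ m → ℚ.toℚᵘ (ℕ→ℚ m) ≡ mkℚᵘ (ℤ.+ m) 0
toℚᵘ-ℕ→ℚ m = cong ℚ.toℚᵘ (ℕ→ℚ≡mkℚ m)

ℕ→ℚ-+ : ∀ m n → ℕ→ℚ (m + n) ≡ ℕ→ℚ m ℚ.+ ℕ→ℚ n
ℕ→ℚ-+ m n = ℚ.toℚᵘ-injective (begin-equality
  ℚ.toℚᵘ (ℕ→ℚ (m + n))                 ≡⟨ toℚᵘ-ℕ→ℚ (m + n) ⟩
  mkℚᵘ (ℤ.+ (m + n)) 0                 ≃⟨ *≡* (cong (ℤ._* ℤ.+ 1) +[m+n]≡) ⟩
  mkℚᵘ (ℤ.+ m) 0 ℚᵘ.+ mkℚᵘ (ℤ.+ n) 0   ≡⟨ cong₂ ℚᵘ._+_ (toℚᵘ-ℕ→ℚ m) (toℚᵘ-ℕ→ℚ n) ⟨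
  ℚ.toℚᵘ (ℕ→ℚ m) ℚᵘ.+ ℚ.toℚᵘ (ℕ→ℚ n)   ≃⟨ ℚ.toℚᵘ-homo-+ (ℕ→ℚ m) (ℕ→ℚ n) ⟨
  ℚ.toℚᵘ (ℕ→ℚ m ℚ.+ ℕ→ℚ n)             ∎)
  where
  open ℚᵘ.≤-Reasoning
  +[m+n]≡ : ℤ.+ (m + n) ≡ ℤ.+ m ℤ.* ℤ.+ 1 ℤ.+ ℤ.+ n ℤ.* ℤ.+ 1
  +[m+n]≡ = trans (ℤ.pos-+ m n) (sym (cong₂ ℤ._+_ (ℤ.*-identityʳ (ℤ.+ m)) (ℤ.*-identityʳ (ℤ.+ n))))

ℕ→ℚ-* : ∀ m n → ℕ→ℚ (m * n) ≡ ℕ→ℚ m ℚ.* ℕ→ℚ n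
ℕ→ℚ-* m n = ℚ.toℚᵘ-injective (begin-equality
  ℚ.toℚᵘ (ℕ→ℚ (m * n))                 ≡⟨ toℚᵘ-ℕ→ℚ (m * n) ⟩
  mkℚᵘ (ℤ.+ (m * n)) 0                 ≃⟨ *≡* (cong (ℤ._* ℤ.+ 1) (ℤ.pos-* m n)) ⟩
  mkℚᵘ (ℤ.+ m) 0 ℚᵘ.* mkℚᵘ (ℤ.+ n) 0   ≡⟨ cong₂ ℚᵘ._*_ (toℚᵘ-ℕ→ℚ m) (toℚᵘ-ℕ→ℚ n) ⟨
  ℚ.toℚᵘ (ℕ→ℚ m) ℚᵘ.* ℚ.toℚᵘ (ℕ→ℚ n)   ≃⟨ ℚ.toℚᵘ-homo-* (ℕ→ℚ m) (ℕ→ℚ n) ⟨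
  ℚ.toℚᵘ (ℕ→ℚ m ℚ.* ℕ→ℚ n)             ∎)
  where open ℚᵘ.≤-Reasoning

ℕ→ℚ-mono-≤ : ∀ {m n} → m ≤ n → ℕ→ℚ m ℚ.≤ ℕ→ℚ n
ℕ→ℚ-mono-≤ {m} {n} m≤n rewrite ℕ→ℚ≡mkℚ m | ℕ→ℚ≡mkℚ n =
  ℚ.*≤* (subst₂ ℤ._≤_ (sym (ℤ.*-identityʳ (ℤ.+ m))) (sym (ℤ.*-identityʳ (ℤ.+ n))) (ℤ.+≤+ m≤n))

ℕ→ℚ-cancel-≤ : ∀ {m n} → ℕ→ℚ m ℚ.≤ ℕ→ℚ n → m ≤ n
ℕ→ℚ-cancel-≤ {m} {n} m≤n rewrite ℕ→ℚ≡mkℚ m | ℕ→ℚ≡mkℚ n =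
  ℤ.drop‿+≤+ (subst₂ ℤ._≤_ (ℤ.*-identityʳ (ℤ.+ m)) (ℤ.*-identityʳ (ℤ.+ n)) (ℚ.drop-*≤* m≤n))

ℕ→ℚ-nonNeg : ∀ m → ℚ.NonNegative (ℕ→ℚ m)
ℕ→ℚ-nonNeg m = ℚ.nonNegative (ℕ→ℚ-mono-≤ {0} {m} z≤n)

ℕ→ℚ-pos : ∀ m → 1 ≤ m → ℚ.Positive (ℕ→ℚ m)
ℕ→ℚ-pos (suc m) _ rewrite ℕ→ℚ≡mkℚ (suc m) = _

ℕ→ℚ-suc-+ : ∀ m g → ℕ→ℚ (suc m) ℚ.+ g ≡ (ℕ→ℚ m ℚ.+ g) ℚ.+ 1ℚ
ℕ→ℚ-suc-+ m g = begin
  ℕ→ℚ (suc m) ℚ.+ g          ≡⟨ cong (λ k → ℕ→ℚ k ℚ.+ g) (ℕ.+-comm 1 m) ⟩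
  ℕ→ℚ (m + 1) ℚ.+ g          ≡⟨ cong (ℚ._+ g) (ℕ→ℚ-+ m 1) ⟩
  (ℕ→ℚ m ℚ.+ 1ℚ) ℚ.+ g       ≡⟨ solveℚ 2 (λ x y → (x :+ con 1ℚ) :+ y := (x :+ y) :+ con 1ℚ) refl (ℕ→ℚ m) g ⟩
  (ℕ→ℚ m ℚ.+ g) ℚ.+ 1ℚ       ∎
  where
  open ≡-Reasoning

record Fraction (X : ℚ) : Set where
  field
    num den   : ℕ
    num≥1     : 1 ≤ num
    den≥1     : 1 ≤ den
    X*den≡num : X ℚ.* ℕ→ℚ den ≡ ℕ→ℚ num
open Fraction

fraction : ∀ {X} → 0ℚ ℚ.< X → Fraction X
fraction {X@(mkℚ +[1+ p ] r _)} _ = record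
  { num = suc p ; den = suc r ; num≥1 = s≤s z≤n ; den≥1 = s≤s z≤n
  ; X*den≡num = ℚ.toℚᵘ-injective (begin-equality
      ℚ.toℚᵘ (X ℚ.* ℕ→ℚ (suc r))                 ≃⟨ ℚ.toℚᵘ-homo-* X (ℕ→ℚ (suc r)) ⟩
      mkℚᵘ +[1+ p ] r ℚᵘ.* ℚ.toℚᵘ (ℕ→ℚ (suc r))  ≡⟨ cong (mkℚᵘ +[1+ p ] r ℚᵘ.*_) (toℚᵘ-ℕ→ℚ (suc r)) ⟩
      mkℚᵘ +[1+ p ] r ℚᵘ.* mkℚᵘ (ℤ.+ suc r) 0    ≃⟨ *≡* (trans (ℤ.*-identityʳ _) (cong (+[1+ p ] ℤ.*_) +[r]≡)) ⟩
      mkℚᵘ (ℤ.+ suc p) 0                         ≡⟨ toℚᵘ-ℕ→ℚ (suc p) ⟨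
      ℚ.toℚᵘ (ℕ→ℚ (suc p))                       ∎)
  }
  where
  open ℚᵘ.≤-Reasoning
  +[r]≡ : ℤ.+ suc r ≡ ℤ.+ (suc r * 1)
  +[r]≡ = cong ℤ.+_ (sym (ℕ.*-identityʳ (suc r)))
fraction {mkℚ +0       _ _} (ℚ.*<* (ℤ.+<+ ()))
fraction {mkℚ -[1+ _ ] _ _} (ℚ.*<* ())

fraction-1 : Fraction 1ℚ
fraction-1 = record { num = 1 ; den = 1 ; num≥1 = s≤s z≤n ; den≥1 = s≤s z≤n ; X*den≡num = refl }

fraction-+1 : ∀ {X Y} → Fraction X → Y ≡ X ℚ.+ 1ℚ → Fraction Y
fraction-+1 {X} {Y} F Y≡X+1 = record
  { num = num F + den F ; den = den F ; num≥1 = ℕ.≤-trans (num≥1 F) (ℕ.m≤m+n _ _) ; den≥1 = den≥1 F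
  ; X*den≡num = begin
      Y ℚ.* R                    ≡⟨ cong (ℚ._* R) Y≡X+1 ⟩
      (X ℚ.+ 1ℚ) ℚ.* R           ≡⟨ solveℚ 2 (λ X R → (X :+ con 1ℚ) :* R := X :* R :+ R) refl X R ⟩
      X ℚ.* R ℚ.+ R              ≡⟨ cong (ℚ._+ R) (X*den≡num F) ⟩
      ℕ→ℚ (num F) ℚ.+ R          ≡⟨ ℕ→ℚ-+ (num F) (den F) ⟨
      ℕ→ℚ (num F + den F)        ∎
  }
  where
  open ≡-Reasoning
  R : ℚ
  R = ℕ→ℚ (den F)

fraction-≤ : ∀ {X Y} → X ℚ.≤ Y → (F : Fraction X) (G : Fraction Y) → num F * den G ≤ num G * den F
fraction-≤ {X} {Y} X≤Y F G = ℕ→ℚ-cancel-≤ (begin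
  ℕ→ℚ (num F * den G)       ≡⟨ ℕ→ℚ-* (num F) (den G) ⟩
  ℕ→ℚ (num F) ℚ.* R₂        ≡⟨ cong (ℚ._* R₂) (X*den≡num F) ⟨
  X ℚ.* R₁ ℚ.* R₂           ≤⟨ ℚ.*-monoʳ-≤-nonNeg R₂ {{ℕ→ℚ-nonNeg (den G)}}
                                 (ℚ.*-monoʳ-≤-nonNeg R₁ {{ℕ→ℚ-nonNeg (den F)}} X≤Y) ⟩
  Y ℚ.* R₁ ℚ.* R₂           ≡⟨ solveℚ 3 (λ Y A B → Y :* A :* B := Y :* B :* A) refl Y R₁ R₂ ⟩
  Y ℚ.* R₂ ℚ.* R₁           ≡⟨ cong (ℚ._* R₁) (X*den≡num G) ⟩
  ℕ→ℚ (num G) ℚ.* R₁        ≡⟨ ℕ→ℚ-* (num G) (den F) ⟨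
  ℕ→ℚ (num G * den F)       ∎)
  where
  open ℚ.≤-Reasoning
  R₁ R₂ : ℚ
  R₁ = ℕ→ℚ (den F)
  R₂ = ℕ→ℚ (den G)

fraction-≤1 : ∀ {X} → X ℚ.≤ 1ℚ → (F : Fraction X) → num F ≤ den F
fraction-≤1 X≤1 F = subst₂ _≤_ (ℕ.*-identityʳ (num F)) (ℕ.+-identityʳ (den F)) (fraction-≤ X≤1 F fraction-1)

module _ {X : ℚ} (X>0 : 0ℚ ℚ.< X) (F : Fraction X) where

  private
    instance
      X≢0 : ℚ.NonZero X
      X≢0 = ℚ.>-nonZero X>0
    P R : ℚ
    P = ℕ→ℚ (num F)
    R = ℕ→ℚ (den F)

    -- Since (1/X)·P = R, multiplying (1 − 1/X)·x by P gives P·x − R·x.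
    ℕ→ℚ-num*≡ : ∀ x → ℕ→ℚ (num F * x) ≡ P ℚ.* ((1ℚ ℚ.- 1/ X) ℚ.* ℕ→ℚ x) ℚ.+ R ℚ.* ℕ→ℚ x
    ℕ→ℚ-num*≡ x = begin
      ℕ→ℚ (num F * x)
        ≡⟨ ℕ→ℚ-* (num F) x ⟩
      P ℚ.* ℕ→ℚ x
        ≡⟨ solveℚ 3 (λ P Z x → P :* x := P :* ((con 1ℚ :- Z) :* x) :+ (Z :* P) :* x) refl P (1/ X) (ℕ→ℚ x) ⟩
      P ℚ.* ((1ℚ ℚ.- 1/ X) ℚ.* ℕ→ℚ x) ℚ.+ (1/ X ℚ.* P) ℚ.* ℕ→ℚ x
        ≡⟨ cong (λ t → P ℚ.* ((1ℚ ℚ.- 1/ X) ℚ.* ℕ→ℚ x) ℚ.+ t ℚ.* ℕ→ℚ x) 1/X*P≡R ⟩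
      P ℚ.* ((1ℚ ℚ.- 1/ X) ℚ.* ℕ→ℚ x) ℚ.+ R ℚ.* ℕ→ℚ x
        ∎
      where
      open ≡-Reasoning
      1/X*P≡R : 1/ X ℚ.* P ≡ R
      1/X*P≡R = begin
        1/ X ℚ.* P            ≡⟨ cong (1/ X ℚ.*_) (X*den≡num F) ⟨
        1/ X ℚ.* (X ℚ.* R)    ≡⟨ ℚ.*-assoc (1/ X) X R ⟨
        (1/ X ℚ.* X) ℚ.* R    ≡⟨ cong (ℚ._* R) (ℚ.*-inverseˡ X) ⟩
        1ℚ ℚ.* R              ≡⟨ ℚ.*-identityˡ R ⟩
        R                     ∎

    ℕ→ℚ-large : ∀ n x → ℕ→ℚ (num F * x + den F * n) ≡ P ℚ.* ℕ→ℚ x ℚ.+ R ℚ.* ℕ→ℚ n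
    ℕ→ℚ-large n x =
      trans (ℕ→ℚ-+ (num F * x) (den F * n)) (cong₂ ℚ._+_ (ℕ→ℚ-* (num F) x) (ℕ→ℚ-* (den F) n))

  large⇒≤ : ∀ n x → Large (num F) (den F) n x → (1ℚ ℚ.- 1/ X) ℚ.* ℕ→ℚ n ℚ.≤ ℕ→ℚ x
  large⇒≤ n x large = ℚ.*-cancelˡ-≤-pos P {{ℕ→ℚ-pos (num F) (num≥1 F)}}
    (subst₂ ℚ._≤_ (cancel-R _) (cancel-R _)
      (ℚ.+-monoˡ-≤ (ℚ.- (R ℚ.* ℕ→ℚ n))
        (subst₂ ℚ._≤_ (ℕ→ℚ-num*≡ n) (ℕ→ℚ-large n x) (ℕ→ℚ-mono-≤ large))))
    where
    cancel-R : ∀ a → a ℚ.+ R ℚ.* ℕ→ℚ n ℚ.+ ℚ.- (R ℚ.* ℕ→ℚ n) ≡ a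
    cancel-R a = solveℚ 2 (λ a b → a :+ b :+ (:- b) := a) refl a (R ℚ.* ℕ→ℚ n)

  ≤⇒large : ∀ n x → (1ℚ ℚ.- 1/ X) ℚ.* ℕ→ℚ n ℚ.≤ ℕ→ℚ x → Large (num F) (den F) n x
  ≤⇒large n x dn≤x = ℕ→ℚ-cancel-≤ (subst₂ ℚ._≤_ (sym (ℕ→ℚ-num*≡ n)) (sym (ℕ→ℚ-large n x))
    (ℚ.+-monoˡ-≤ (R ℚ.* ℕ→ℚ n) (ℚ.*-monoˡ-≤-nonNeg P {{ℕ→ℚ-nonNeg (num F)}} dn≤x)))

  deltaChiGood⇒admissible : ∀ {a b k} →
    DeltaChiGood a b k (1ℚ ℚ.- 1/ X) → Admissible a b k (num F) (den F)
  deltaChiGood⇒admissible good n G lp large = good n G lp (λ v → large⇒≤ n (deg G v) (large v))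

  admissible⇒deltaChiGood : ∀ {a b k} →
    Admissible a b k (num F) (den F) → DeltaChiGood a b k (1ℚ ℚ.- 1/ X)
  admissible⇒deltaChiGood adm n G lp dense = adm n G lp (λ v → ≤⇒large n (deg G v) (dense v))

⊔-<-lub : ∀ {p q r} → p ℚ.< r → q ℚ.< r → p ℚ.⊔ q ℚ.< r
⊔-<-lub {p} {q} p<r q<r with ℚ.⊔-sel p q
... | inj₁ p⊔q≡p = subst (ℚ._< _) (sym p⊔q≡p) p<r
... | inj₂ p⊔q≡q = subst (ℚ._< _) (sym p⊔q≡q) q<r

-- When the witness for γ_{a+2,b+1} gives no positive denominator for γ_{a+1,b+1}, its density 1 − 1/X is ≤ 0,
-- which is impossible since 𝓕_{a+2,b+1} contains graphs that are not (a+b+3)-colourable.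
gammaBelow-mono : ∀ a b q → GammaBelow (suc (suc a)) (suc b) q → GammaBelow (suc a) (suc b) q
gammaBelow-mono a b q (g , g<q , X>0 , good) with 0ℚ ℚ.<? ℕ→ℚ (a + suc b) ℚ.+ g
... | yes C>0 = g , g<q , C>0 , admissible⇒deltaChiGood C>0 F (admissible-cone (num≥1 F) (den≥1 F) adm)
  where
  F : Fraction (ℕ→ℚ (a + suc b) ℚ.+ g)
  F = fraction C>0
  adm : Admissible (suc (suc a)) (suc b) (suc (suc a) + suc b) (num F + den F) (den F)
  adm = deltaChiGood⇒admissible X>0 (fraction-+1 F (ℕ→ℚ-suc-+ (a + suc b) g)) good
... | no C≯0 = ⊥-elim (¬admissible-trivial (fraction-≤1 X≤1 F) (deltaChiGood⇒admissible X>0 F good))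
  where
  F : Fraction (ℕ→ℚ (suc a + suc b) ℚ.+ g)
  F = fraction X>0
  X≤1 : ℕ→ℚ (suc a + suc b) ℚ.+ g ℚ.≤ 1ℚ
  X≤1 = subst₂ ℚ._≤_ (sym (ℕ→ℚ-suc-+ (a + suc b) g)) (ℚ.+-identityˡ 1ℚ)
               (ℚ.+-monoˡ-≤ 1ℚ (ℚ.≮⇒≥ C≯0))

gammaBelow-suc : ∀ a b q → GammaBelow (suc a) b q → GammaBelow 1 (suc a + b) q → GammaBelow (suc (suc a)) b q
gammaBelow-suc a b q (g₁ , g₁<q , X₁>0 , good₁) (g₂ , g₂<q , X₂>0 , good₂) =
  g , ⊔-<-lub g₁<q g₂<q , X>0 ,
  admissible⇒deltaChiGood X>0 F (admissible-local {r = den F} {num F₁} {den F₁} (num≥1 F) ratio adm₁ adm₂)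
  where
  g : ℚ
  g = g₁ ℚ.⊔ g₂
  X₂≤X : ℕ→ℚ (suc a + b) ℚ.+ g₂ ℚ.≤ ℕ→ℚ (suc a + b) ℚ.+ g
  X₂≤X = ℚ.+-monoʳ-≤ (ℕ→ℚ (suc a + b)) (ℚ.p≤q⊔p g₁ g₂)
  X>0 : 0ℚ ℚ.< ℕ→ℚ (suc a + b) ℚ.+ g
  X>0 = ℚ.<-≤-trans X₂>0 X₂≤X
  X₁+1≤X : (ℕ→ℚ (a + b) ℚ.+ g₁) ℚ.+ 1ℚ ℚ.≤ ℕ→ℚ (suc a + b) ℚ.+ g
  X₁+1≤X = subst (ℚ._≤ ℕ→ℚ (suc a + b) ℚ.+ g) (ℕ→ℚ-suc-+ (a + b) g₁)
                 (ℚ.+-monoʳ-≤ (ℕ→ℚ (suc a + b)) (ℚ.p≤p⊔q g₁ g₂))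
  F : Fraction (ℕ→ℚ (suc a + b) ℚ.+ g)
  F = fraction X>0
  F₁ : Fraction (ℕ→ℚ (a + b) ℚ.+ g₁)
  F₁ = fraction X₁>0
  F₂ : Fraction (ℕ→ℚ (suc a + b) ℚ.+ g₂)
  F₂ = fraction X₂>0
  ratio : (num F₁ + den F₁) * den F ≤ num F * den F₁
  ratio = fraction-≤ X₁+1≤X (fraction-+1 F₁ refl) F
  adm₁ : Admissible (suc a) b (suc a + b) (num F₁) (den F₁)
  adm₁ = deltaChiGood⇒admissible X₁>0 F₁ good₁
  adm₂ : Admissible 1 (suc a + b) (suc (suc a + b)) (num F) (den F)
  adm₂ = admissible-mono {p′ = num F₂} {den F₂} (num≥1 F) (fraction-≤ X₂≤X F₂ F)
                         (deltaChiGood⇒admissible X₂>0 F₂ good₂)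

lemma5p2 : ∀ (a b : ℕ) → 1 ≤ a → 1 ≤ b →
    -- γ_{a,b} ≤ γ_{a+1,b}
    ((q : ℚ) → GammaBelow (suc a) b q → GammaBelow a b q)
    -- γ_{a+1,b} ≤ max {γ_{a,b}, γ_{1,a+b}}
    × ((q : ℚ) → GammaBelow a b q → GammaBelow 1 (a + b) q → GammaBelow (suc a) b q)
lemma5p2 (suc a) (suc b) _ _ = gammaBelow-mono a b , gammaBelow-suc a (suc b)
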